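{- For every integer $n\ge 2$, \[ \det\left[ \binom{n-i+j}{i} \right]_{i,j=1}^{n-1} = C_n, \] where $C_n=\frac{1}{n+1}\binom{2n}{n}$ is the $n$-th Catalan number. -}

module Defs where

open import Data.Nat using (ℕ; zero; suc; _+_; _∸_)
open import Data.Nat.Combinatorics using (_C_)
open import Data.Nat.DivMod using (_/_)
open import Data.Fin using (Fin; toℕ; punchIn)
import Data.Fin as F
open import Data.Integer using (ℤ; +_; -_) renaming (_+_ to _+ℤ_; _*_ to _*ℤ_)

Matrix : ℕ → Set
Matrix m = Fin m → Fin m → ℤ

sign : ℕ → ℤ
sign zero = + 1
sign (suc k) = - sign k

sumFin : (m : ℕ) → (Fin m → ℤ) → ℤ
sumFin zero f = + 0
sumFin (suc m) f = f F.zero +ℤ sumFin m (λ j → f (F.suc j))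

det : (m : ℕ) → Matrix m → ℤ
det zero A = + 1
det (suc m) A =
  sumFin (suc m) (λ j → sign (toℕ j) *ℤ (A F.zero j *ℤ
    det m (λ r c → A (F.suc r) (punchIn j c))))

-- The (n-1)×(n-1) matrix [ binom(n-i+j, i) ]_{i,j=1}^{n-1},
-- written with 0-based indices r = i-1, c = j-1.
binomMatrix : (n : ℕ) → Matrix (n ∸ 1)
binomMatrix n r c = + ((n ∸ suc (toℕ r) + suc (toℕ c)) C suc (toℕ r))

catalan : ℕ → ℕ
catalan n = ((n + n) C n) / suc n

module Submission where

-- Column j of the matrix is the vector x ↦ C(x − i, i) evaluated at x = n + j. Subtracting
-- neighbouring columns (Newton's forward differences) replaces column j by the (j − 1)-th
-- difference at x = n + 1, giving the lower Hessenberg matrix [C(a − i, i − j + 1)] with a = n + 1,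
-- whose superdiagonal is 1. Call its m × m determinant D_m(a). Pascal's rule expresses each column
-- for a + 1 as the sum of two neighbouring columns for a, and multilinearity yields
-- D_m(a + 1) = D_m(a) + D_{m−1}(a + 1), while D_m(m) = 0 since its last row vanishes. These are the
-- recurrence and boundary values of the ballot numbers, so D_m(n + 1) = C(n + m, m) − C(n + m, m − 1),
-- and for m = n − 1 this difference is the Catalan number C_n.

open import Defs
open import Data.Nat as ℕ using (ℕ; zero; suc; _≤_; _<_; _∸_; z≤n; s≤s)
import Data.Nat.Properties as ℕₚ
open import Data.Nat.Combinatorics using (_C_; nCk+nC[k+1]≡[n+1]C[k+1]; nCk≡nC[n∸k]; nC1≡n)
open import Data.Nat.DivMod using (_/_; m*n/n≡m)
open import Data.Nat.Tactic.RingSolver using () renaming (solve-∀ to ℕ-solve-∀)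
open import Data.Integer using (ℤ; +_; -_; _+_; _-_; _*_; _⊖_)
open import Data.Integer.Properties
  using (+-*-semiring; +-identityʳ; *-identityˡ; +-inverseʳ; pos-+; m-n≡m⊖n; ⊖-≥)
open import Data.Integer.Tactic.RingSolver using (solve-∀)
open import Algebra.Properties.Semiring.Sum +-*-semiring
  using (sum; sum-cong-≗; sum-replicate-zero; sum-remove; sum-init-last; ∑-distrib-+; *-distribˡ-sum)
open import Data.Fin using (Fin; zero; suc; toℕ; punchIn; punchOut; inject₁; fromℕ; fromℕ<)
open import Data.Fin.Properties
  using (_≟_; punchInᵢ≢i; punchIn-injective; punchIn-punchOut; toℕ-inject₁; toℕ-injective; toℕ<n;
         toℕ-fromℕ<; toℕ-fromℕ)
open import Data.Vec.Functional using (updateAt)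
open import Data.Vec.Functional.Properties using (updateAt-updates; updateAt-minimal)
open import Data.Product using (Σ; _×_; _,_)
open import Data.Sum using (inj₁; inj₂)
open import Function using (_∘_; const)
open import Relation.Nullary using (¬_; yes; no; contradiction)
open import Relation.Binary using (tri<; tri≈; tri>)
open import Relation.Binary.PropositionalEquality
  using (_≡_; _≢_; refl; sym; trans; cong; cong₂; subst; subst₂; module ≡-Reasoning)
open ≡-Reasoning

-- Laplace expansion and its consequences

punchIn-avoids : ∀ {m} {j p : Fin (suc m)} (j≢p : j ≢ p) (c : Fin m) → c ≢ punchOut j≢p → punchIn j c ≢ p
punchIn-avoids {j = j} j≢p c c≢p′ eq = c≢p′ (punchIn-injective j c _ (trans eq (sym (punchIn-punchOut j≢p))))

punchIn-inject₁-self : ∀ {m} (i : Fin m) → punchIn (inject₁ i) i ≡ suc i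
punchIn-inject₁-self zero    = refl
punchIn-inject₁-self (suc i) = cong suc (punchIn-inject₁-self i)

punchIn-inject₁≗punchIn-suc : ∀ {m} {X : Set} (f : Fin (suc m) → X) (i : Fin m) → f (inject₁ i) ≡ f (suc i) →
                              ∀ c → f (punchIn (inject₁ i) c) ≡ f (punchIn (suc i) c)
punchIn-inject₁≗punchIn-suc f zero    same zero    = sym same
punchIn-inject₁≗punchIn-suc f zero    same (suc c) = refl
punchIn-inject₁≗punchIn-suc f (suc i) same zero    = refl
punchIn-inject₁≗punchIn-suc f (suc i) same (suc c) = punchIn-inject₁≗punchIn-suc (f ∘ suc) i same c

punchIn-preservesAdjacent : ∀ {m} (j : Fin (suc (suc m))) (i : Fin (suc m)) → j ≢ inject₁ i → j ≢ suc i →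
                            Σ (Fin m) λ i′ → punchIn j (inject₁ i′) ≡ inject₁ i × punchIn j (suc i′) ≡ suc i
punchIn-preservesAdjacent         zero          zero    j≢i _     = contradiction refl j≢i
punchIn-preservesAdjacent         zero          (suc i) _   _     = i , refl , refl
punchIn-preservesAdjacent         (suc zero)    zero    _   j≢1+i = contradiction refl j≢1+i
punchIn-preservesAdjacent {suc m} (suc (suc j)) zero    _   _     = zero , refl , refl
punchIn-preservesAdjacent {suc m} (suc j)       (suc i) j≢i j≢1+i
  with punchIn-preservesAdjacent j i (j≢i ∘ cong suc) (j≢1+i ∘ cong suc)
... | i′ , at-i , at-1+i = suc i′ , cong suc at-i , cong suc at-1+i

punchIn-inject₁-inject₁ : ∀ {m} (j : Fin (suc m)) (c : Fin m) → punchIn (inject₁ j) (inject₁ c) ≡ inject₁ (punchIn j c)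
punchIn-inject₁-inject₁ zero    c       = refl
punchIn-inject₁-inject₁ (suc j) zero    = refl
punchIn-inject₁-inject₁ (suc j) (suc c) = cong suc (punchIn-inject₁-inject₁ j c)

punchIn-inject₁-fromℕ : ∀ m (j : Fin (suc m)) → punchIn (inject₁ j) (fromℕ m) ≡ fromℕ (suc m)
punchIn-inject₁-fromℕ m       zero    = refl
punchIn-inject₁-fromℕ (suc m) (suc j) = cong suc (punchIn-inject₁-fromℕ m j)

inject₁≢suc : ∀ {m} (i : Fin m) → inject₁ i ≢ suc i
inject₁≢suc i eq = ℕₚ.1+n≢n (sym (trans (sym (toℕ-inject₁ i)) (cong toℕ eq)))

sum-zero : ∀ {m} {f : Fin m → ℤ} → (∀ j → f j ≡ + 0) → sum f ≡ + 0
sum-zero {m} f≗0 = trans (sum-cong-≗ f≗0) (sum-replicate-zero m)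

sumFin≡sum : ∀ m (f : Fin m → ℤ) → sumFin m f ≡ sum f
sumFin≡sum zero    f = refl
sumFin≡sum (suc m) f = cong (_+_ (f zero)) (sumFin≡sum m (f ∘ suc))

minor : ∀ {m} → Matrix (suc m) → Fin (suc m) → Matrix m
minor A j r c = A (suc r) (punchIn j c)

cofactorTerm : ∀ {m} → Matrix (suc m) → Fin (suc m) → ℤ
cofactorTerm {m} A j = sign (toℕ j) * (A zero j * det m (minor A j))

det-laplace : ∀ m (A : Matrix (suc m)) → det (suc m) A ≡ sum (cofactorTerm A)
det-laplace m A = sumFin≡sum (suc m) (cofactorTerm A)

cofactorTerm-zeroEntry : ∀ {m} (A : Matrix (suc m)) j → A zero j ≡ + 0 → cofactorTerm A j ≡ + 0
cofactorTerm-zeroEntry {m} A j a≡0 =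
  trans (cong (λ a → sign (toℕ j) * (a * det m (minor A j))) a≡0) (vanish (sign (toℕ j)) (det m (minor A j)))
  where vanish : ∀ s d → s * (+ 0 * d) ≡ + 0
        vanish = solve-∀

cofactorTerm-zeroMinor : ∀ {m} (A : Matrix (suc m)) j → det m (minor A j) ≡ + 0 → cofactorTerm A j ≡ + 0
cofactorTerm-zeroMinor A j d≡0 =
  trans (cong (λ d → sign (toℕ j) * (A zero j * d)) d≡0) (vanish (sign (toℕ j)) (A zero j))
  where vanish : ∀ s a → s * (a * + 0) ≡ + 0
        vanish = solve-∀

det-cong : ∀ m {A B : Matrix m} → (∀ r c → A r c ≡ B r c) → det m A ≡ det m B
det-cong zero    _           = refl
det-cong (suc m) {A} {B} A≗B = begin
  det (suc m) A        ≡⟨ det-laplace m A ⟩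
  sum (cofactorTerm A) ≡⟨ sum-cong-≗ termwise ⟩
  sum (cofactorTerm B) ≡⟨ det-laplace m B ⟨
  det (suc m) B        ∎
  where
  termwise : ∀ j → cofactorTerm A j ≡ cofactorTerm B j
  termwise j = cong₂ (λ a d → sign (toℕ j) * (a * d)) (A≗B zero j)
                     (det-cong m λ r c → A≗B (suc r) (punchIn j c))

det-zeroRow : ∀ m (A : Matrix m) r → (∀ c → A r c ≡ + 0) → det m A ≡ + 0
det-zeroRow (suc m) A zero    row≡0 =
  trans (det-laplace m A) (sum-zero λ j → cofactorTerm-zeroEntry A j (row≡0 j))
det-zeroRow (suc m) A (suc r) row≡0 =
  trans (det-laplace m A) (sum-zero λ j →
    cofactorTerm-zeroMinor A j (det-zeroRow m (minor A j) r λ c → row≡0 (punchIn j c)))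

det-linear : ∀ m (A B D : Matrix m) (p : Fin m) k →
             (∀ r c → c ≢ p → A r c ≡ B r c) → (∀ r c → c ≢ p → D r c ≡ B r c) →
             (∀ r → A r p ≡ B r p + k * D r p) → det m A ≡ det m B + k * det m D
det-linear (suc m) A B D p k A≗B D≗B A-at-p = begin
  det (suc m) A
    ≡⟨ det-laplace m A ⟩
  sum (cofactorTerm A)
    ≡⟨ sum-cong-≗ termwise ⟩
  sum (λ j → cofactorTerm B j + k * cofactorTerm D j)
    ≡⟨ ∑-distrib-+ (cofactorTerm B) (λ j → k * cofactorTerm D j) ⟩
  sum (cofactorTerm B) + sum (λ j → k * cofactorTerm D j)
    ≡⟨ cong (_+_ (sum (cofactorTerm B))) (*-distribˡ-sum k (cofactorTerm D)) ⟨
  sum (cofactorTerm B) + k * sum (cofactorTerm D)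
    ≡⟨ cong₂ (λ b d → b + k * d) (det-laplace m B) (det-laplace m D) ⟨
  det (suc m) B + k * det (suc m) D
    ∎
  where
  termwise : ∀ j → cofactorTerm A j ≡ cofactorTerm B j + k * cofactorTerm D j
  termwise j with j ≟ p
  ... | yes refl = begin
    s * (A zero j * det m (minor A j))
      ≡⟨ cong₂ (λ a d → s * (a * d)) (A-at-p zero) (det-cong m minorA≗minorB) ⟩
    s * ((B zero j + k * D zero j) * det m (minor B j))
      ≡⟨ linear-entry s (B zero j) (D zero j) (det m (minor B j)) k ⟩
    s * (B zero j * det m (minor B j)) + k * (s * (D zero j * det m (minor B j)))
      ≡⟨ cong (λ d → cofactorTerm B j + k * (s * (D zero j * d))) (det-cong m minorD≗minorB) ⟨
    cofactorTerm B j + k * cofactorTerm D j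
      ∎
    where
    s = sign (toℕ j)
    minorA≗minorB : ∀ r c → minor A j r c ≡ minor B j r c
    minorA≗minorB r c = A≗B (suc r) (punchIn j c) (punchInᵢ≢i j c)
    minorD≗minorB : ∀ r c → minor D j r c ≡ minor B j r c
    minorD≗minorB r c = D≗B (suc r) (punchIn j c) (punchInᵢ≢i j c)
    linear-entry : ∀ s b d x k → s * ((b + k * d) * x) ≡ s * (b * x) + k * (s * (d * x))
    linear-entry = solve-∀
  ... | no j≢p = begin
    s * (A zero j * det m (minor A j))
      ≡⟨ cong₂ (λ a d → s * (a * d)) (A≗B zero j j≢p) minor-linear ⟩
    s * (B zero j * (det m (minor B j) + k * det m (minor D j)))
      ≡⟨ linear-minor s (B zero j) (det m (minor B j)) (det m (minor D j)) k ⟩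
    s * (B zero j * det m (minor B j)) + k * (s * (B zero j * det m (minor D j)))
      ≡⟨ cong (λ d → cofactorTerm B j + k * (s * (d * det m (minor D j)))) (D≗B zero j j≢p) ⟨
    cofactorTerm B j + k * cofactorTerm D j
      ∎
    where
    s = sign (toℕ j)
    minor-linear : det m (minor A j) ≡ det m (minor B j) + k * det m (minor D j)
    minor-linear = det-linear m (minor A j) (minor B j) (minor D j) (punchOut j≢p) k
      (λ r c c≢p′ → A≗B (suc r) (punchIn j c) (punchIn-avoids j≢p c c≢p′))
      (λ r c c≢p′ → D≗B (suc r) (punchIn j c) (punchIn-avoids j≢p c c≢p′))
      (λ r → subst (λ c → A (suc r) c ≡ B (suc r) c + k * D (suc r) c)
                   (sym (punchIn-punchOut j≢p)) (A-at-p (suc r)))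
    linear-minor : ∀ s b x y k → s * (b * (x + k * y)) ≡ s * (b * x) + k * (s * (b * y))
    linear-minor = solve-∀

VanishesOnEqualColumns : ∀ m → Fin m → Fin m → Set
VanishesOnEqualColumns m p q = ∀ (A : Matrix m) → (∀ r → A r p ≡ A r q) → det m A ≡ + 0

-- Expanding along the first row, the cofactors at the two equal columns cancel by their opposite
-- signs, and every other minor still has two equal adjacent columns.
det-equalAdjacentColumns : ∀ m (i : Fin m) → VanishesOnEqualColumns (suc m) (inject₁ i) (suc i)
det-equalAdjacentColumns (suc m) i A same = begin
  det (suc (suc m)) A
    ≡⟨ det-laplace (suc m) A ⟩
  sum t
    ≡⟨ sum-remove {i = inject₁ i} t ⟩
  t (inject₁ i) + sum (t ∘ punchIn (inject₁ i))
    ≡⟨ cong (_+_ (t (inject₁ i))) (sum-remove {i = i} (t ∘ punchIn (inject₁ i))) ⟩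
  t (inject₁ i) + (t (punchIn (inject₁ i) i) + sum (t ∘ others))
    ≡⟨ cong₂ (λ x y → t (inject₁ i) + (t x + y)) (punchIn-inject₁-self i) (sum-zero others-vanish) ⟩
  t (inject₁ i) + (t (suc i) + + 0)
    ≡⟨ cong₂ (λ x y → x + (y + + 0)) t-inject₁ t-suc ⟩
  s * (a * d) + (- s * (a * d) + + 0)
    ≡⟨ cancel s a d ⟩
  + 0
    ∎
  where
  t = cofactorTerm A
  s = sign (toℕ i)
  a = A zero (inject₁ i)
  d = det (suc m) (minor A (inject₁ i))
  t-inject₁ : t (inject₁ i) ≡ s * (a * d)
  t-inject₁ = cong (λ k → sign k * (a * d)) (toℕ-inject₁ i)
  t-suc : t (suc i) ≡ - s * (a * d)
  t-suc = cong₂ (λ x y → - s * (x * y)) (sym (same zero))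
                (det-cong (suc m) λ r → sym ∘ punchIn-inject₁≗punchIn-suc (A (suc r)) i (same (suc r)))
  others : Fin m → Fin (suc (suc m))
  others = punchIn (inject₁ i) ∘ punchIn i
  others≢suc : ∀ c → others c ≢ suc i
  others≢suc c eq = punchInᵢ≢i i c (punchIn-injective (inject₁ i) _ _ (trans eq (sym (punchIn-inject₁-self i))))
  others-vanish : ∀ c → t (others c) ≡ + 0
  others-vanish c with punchIn-preservesAdjacent (others c) i (punchInᵢ≢i (inject₁ i) (punchIn i c)) (others≢suc c)
  ... | i′ , at-i , at-1+i = cofactorTerm-zeroMinor A (others c) (det-equalAdjacentColumns m i′ (minor A (others c)) λ r →
          trans (cong (A (suc r)) at-i) (trans (same (suc r)) (cong (A (suc r)) (sym at-1+i))))
  cancel : ∀ s a d → s * (a * d) + (- s * (a * d) + + 0) ≡ + 0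
  cancel = solve-∀

det-addColumnMultiple : ∀ m (p q : Fin m) → p ≢ q → VanishesOnEqualColumns m p q →
                        ∀ (A B : Matrix m) k → (∀ r c → c ≢ p → B r c ≡ A r c) →
                        (∀ r → B r p ≡ A r p + k * A r q) → det m B ≡ det m A
det-addColumnMultiple m p q p≢q vanishes A B k B≗A B-at-p = begin
  det m B                      ≡⟨ det-linear m B A A[p≔q] p k B≗A A[p≔q]≗A B-at-p′ ⟩
  det m A + k * det m A[p≔q]   ≡⟨ cong (λ d → det m A + k * d) (vanishes A[p≔q] A[p≔q]-equalColumns) ⟩
  det m A + k * + 0            ≡⟨ drop (det m A) k ⟩
  det m A                      ∎
  where
  A[p≔q] : Matrix m
  A[p≔q] r = updateAt (A r) p (const (A r q))
  A[p≔q]≗A : ∀ r c → c ≢ p → A[p≔q] r c ≡ A r c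
  A[p≔q]≗A r c c≢p = updateAt-minimal c p (A r) c≢p
  A[p≔q]-equalColumns : ∀ r → A[p≔q] r p ≡ A[p≔q] r q
  A[p≔q]-equalColumns r = trans (updateAt-updates p (A r)) (sym (A[p≔q]≗A r q (p≢q ∘ sym)))
  B-at-p′ : ∀ r → B r p ≡ A r p + k * A[p≔q] r p
  B-at-p′ r = trans (B-at-p r) (cong (λ x → A r p + k * x) (sym (updateAt-updates p (A r))))
  drop : ∀ d k → d + k * + 0 ≡ d
  drop = solve-∀

det-unitLastColumn : ∀ m (A : Matrix (suc m)) →
                     (∀ r → A (inject₁ r) (fromℕ m) ≡ + 0) → A (fromℕ m) (fromℕ m) ≡ + 1 →
                     det (suc m) A ≡ det m (λ r c → A (inject₁ r) (inject₁ c))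
det-unitLastColumn zero    A _       corner≡1 rewrite corner≡1 = refl
det-unitLastColumn (suc m) A above≡0 corner≡1 = begin
  det (suc (suc m)) A                     ≡⟨ det-laplace (suc m) A ⟩
  sum t                                   ≡⟨ sum-init-last t ⟩
  sum (t ∘ inject₁) + t (fromℕ (suc m))   ≡⟨ cong₂ _+_ (sum-cong-≗ t-inject₁) (cofactorTerm-zeroEntry A _ (above≡0 zero)) ⟩
  sum (cofactorTerm A′) + + 0             ≡⟨ cong (_+ + 0) (det-laplace m A′) ⟨
  det (suc m) A′ + + 0                    ≡⟨ +-identityʳ _ ⟩
  det (suc m) A′                          ∎
  where
  t = cofactorTerm A
  A′ : Matrix (suc m)
  A′ r c = A (inject₁ r) (inject₁ c)
  lastColumn = punchIn-inject₁-fromℕ m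
  t-inject₁ : ∀ j → t (inject₁ j) ≡ cofactorTerm A′ j
  t-inject₁ j = cong₂ (λ k d → sign k * (A zero (inject₁ j) * d)) (toℕ-inject₁ j) (begin
    det (suc m) (minor A (inject₁ j))
      ≡⟨ det-unitLastColumn m (minor A (inject₁ j))
           (λ r → trans (cong (A (suc (inject₁ r))) (lastColumn j)) (above≡0 (suc r)))
           (trans (cong (A (suc (fromℕ m))) (lastColumn j)) corner≡1) ⟩
    det m (λ r c → A (suc (inject₁ r)) (punchIn (inject₁ j) (inject₁ c)))
      ≡⟨ det-cong m (λ r c → cong (A (suc (inject₁ r))) (punchIn-inject₁-inject₁ j c)) ⟩
    det m (minor A′ j)
      ∎)

-- Matrices given by a family of columns

columns : ∀ m → (ℕ → ℕ → ℤ) → Matrix m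
columns m v r c = v (toℕ c) (toℕ r)

det-columns-cong : ∀ m {v w : ℕ → ℕ → ℤ} → (∀ c r → c < m → r < m → v c r ≡ w c r) →
                   det m (columns m v) ≡ det m (columns m w)
det-columns-cong m v≗w = det-cong m λ r c → v≗w (toℕ c) (toℕ r) (toℕ<n c) (toℕ<n r)

toℕ-≢ : ∀ {m} {c P : Fin m} {p} → toℕ P ≡ p → c ≢ P → toℕ c ≢ p
toℕ-≢ P↦p c≢P c↦p = c≢P (toℕ-injective (trans c↦p (sym P↦p)))

det-columns-additive : ∀ m (x y z : ℕ → ℕ → ℤ) p → p < m →
                       (∀ c r → c < m → c ≢ p → x c r ≡ y c r) → (∀ c r → c < m → c ≢ p → z c r ≡ y c r) →
                       (∀ r → x p r ≡ y p r + z p r) →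
                       det m (columns m x) ≡ det m (columns m y) + det m (columns m z)
det-columns-additive m x y z p p<m x≗y z≗y x-at-p = begin
  det m (columns m x)
    ≡⟨ det-linear m (columns m x) (columns m y) (columns m z) P (+ 1)
         (λ r c c≢P → x≗y (toℕ c) (toℕ r) (toℕ<n c) (toℕ-≢ P↦p c≢P))
         (λ r c c≢P → z≗y (toℕ c) (toℕ r) (toℕ<n c) (toℕ-≢ P↦p c≢P))
         x-at-P ⟩
  det m (columns m y) + + 1 * det m (columns m z)
    ≡⟨ cong (_+_ (det m (columns m y))) (*-identityˡ _) ⟩
  det m (columns m y) + det m (columns m z)
    ∎
  where
  P = fromℕ< p<m
  P↦p = toℕ-fromℕ< p<m
  x-at-P : ∀ r → x (toℕ P) (toℕ r) ≡ y (toℕ P) (toℕ r) + + 1 * z (toℕ P) (toℕ r)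
  x-at-P r = subst (λ c → x c (toℕ r) ≡ y c (toℕ r) + + 1 * z c (toℕ r)) (sym P↦p)
               (trans (x-at-p (toℕ r)) (cong (_+_ (y p (toℕ r))) (sym (*-identityˡ _))))

det-columns-unitLast : ∀ k (v : ℕ → ℕ → ℤ) → (∀ r → r < k → v k r ≡ + 0) → v k k ≡ + 1 →
                       det (suc k) (columns (suc k) v) ≡ det k (columns k v)
det-columns-unitLast k v above≡0 corner≡1 = begin
  det (suc k) (columns (suc k) v)
    ≡⟨ det-unitLastColumn k (columns (suc k) v)
         (λ r → trans (cong₂ v (toℕ-fromℕ k) (toℕ-inject₁ r)) (above≡0 (toℕ r) (toℕ<n r)))
         (trans (cong₂ v (toℕ-fromℕ k) (toℕ-fromℕ k)) corner≡1) ⟩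
  det k (λ r c → v (toℕ (inject₁ c)) (toℕ (inject₁ r)))
    ≡⟨ det-cong k (λ r c → cong₂ v (toℕ-inject₁ c) (toℕ-inject₁ r)) ⟩
  det k (columns k v)
    ∎

det-columns-addColumn : ∀ m (P Q : Fin m) → P ≢ Q → VanishesOnEqualColumns m P Q →
                        ∀ {p q} → toℕ P ≡ p → toℕ Q ≡ q → ∀ (v w : ℕ → ℕ → ℤ) k →
                        (∀ c r → c ≢ p → w c r ≡ v c r) → (∀ r → w p r ≡ v p r + k * v q r) →
                        det m (columns m w) ≡ det m (columns m v)
det-columns-addColumn m P Q P≢Q vanishes P↦p Q↦q v w k w≗v w-at-p =
  det-addColumnMultiple m P Q P≢Q vanishes (columns m v) (columns m w) k
    (λ r c c≢P → w≗v (toℕ c) (toℕ r) (toℕ-≢ P↦p c≢P))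
    (λ r → subst₂ (λ c c′ → w c (toℕ r) ≡ v c (toℕ r) + k * v c′ (toℕ r)) (sym P↦p) (sym Q↦q) (w-at-p (toℕ r)))

det-columns-addNext : ∀ m c → suc c < m → ∀ (v w : ℕ → ℕ → ℤ) k →
                      (∀ c′ r → c′ ≢ c → w c′ r ≡ v c′ r) → (∀ r → w c r ≡ v c r + k * v (suc c) r) →
                      det m (columns m w) ≡ det m (columns m v)
det-columns-addNext (suc m) c (s≤s c<m) =
  det-columns-addColumn (suc m) (inject₁ i) (suc i) (inject₁≢suc i) (det-equalAdjacentColumns m i)
    (trans (toℕ-inject₁ i) (toℕ-fromℕ< c<m)) (cong suc (toℕ-fromℕ< c<m))
  where i = fromℕ< c<m

det-columns-addPrevious : ∀ m c → suc c < m → ∀ (v w : ℕ → ℕ → ℤ) k →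
                          (∀ c′ r → c′ ≢ suc c → w c′ r ≡ v c′ r) →
                          (∀ r → w (suc c) r ≡ v (suc c) r + k * v c r) →
                          det m (columns m w) ≡ det m (columns m v)
det-columns-addPrevious (suc m) c (s≤s c<m) =
  det-columns-addColumn (suc m) (suc i) (inject₁ i) (inject₁≢suc i ∘ sym)
    (λ A same → det-equalAdjacentColumns m i A (sym ∘ same))
    (cong suc (toℕ-fromℕ< c<m)) (trans (toℕ-inject₁ i) (toℕ-fromℕ< c<m))
  where i = fromℕ< c<m

splice : ℕ → (ℕ → ℕ → ℤ) → (ℕ → ℕ → ℤ) → ℕ → ℕ → ℤ
splice t u v c with c ℕ.<? t
... | yes _ = u c
... | no  _ = v c

splice-< : ∀ {t c} u v r → c < t → splice t u v c r ≡ u c r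
splice-< {t} {c} u v r c<t with c ℕ.<? t
... | yes _   = refl
... | no  c≮t = contradiction c<t c≮t

splice-≮ : ∀ t {c} u v r → ¬ c < t → splice t u v c r ≡ v c r
splice-≮ t {c} u v r c≮t with c ℕ.<? t
... | yes c<t = contradiction c<t c≮t
... | no  _   = refl

splice-new : ∀ t u v r → splice (suc t) u v t r ≡ u t r
splice-new t u v r = splice-< u v r (ℕₚ.n<1+n t)

splice-old : ∀ t u v r → splice t u v t r ≡ v t r
splice-old t u v r = splice-≮ t u v r (ℕₚ.<-irrefl refl)

splice-suc-≢ : ∀ t {c} u v r → c ≢ t → splice (suc t) u v c r ≡ splice t u v c r
splice-suc-≢ t {c} u v r c≢t with c ℕ.<? t
... | yes c<t = splice-< u v r (ℕₚ.m<n⇒m<1+n c<t)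
... | no  c≮t = splice-≮ (suc t) u v r λ c<1+t → c≮t (ℕₚ.≤∧≢⇒< (ℕₚ.≤-pred c<1+t) c≢t)

stepwise-constant : (P : ℕ → ℤ) → (∀ t → P t ≡ P (suc t)) → ∀ t → P 0 ≡ P t
stepwise-constant P step zero    = refl
stepwise-constant P step (suc t) = trans (stepwise-constant P step t) (step t)

-- The column operations are performed one at a time, left to right: stage t has the columns of w
-- before t and those of v from t on, so the column added to column t is still untouched.
det-columns-addNextBelow : ∀ m k → k < m → ∀ (v w : ℕ → ℕ → ℤ) →
                           (∀ c r → c < k → w c r ≡ v c r + v (suc c) r) → (∀ c r → k ≤ c → w c r ≡ v c r) →
                           det m (columns m w) ≡ det m (columns m v)
det-columns-addNextBelow m k k<m v w w-below w-above = begin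
  det m (columns m w)             ≡⟨ det-columns-cong m (λ c r c<m _ → splice-< w v r c<m) ⟨
  det m (columns m (stage m))     ≡⟨ stepwise-constant (λ t → det m (columns m (stage t))) step m ⟨
  det m (columns m (stage 0))     ≡⟨ det-columns-cong m (λ c r _ _ → splice-≮ 0 {c} w v r λ ()) ⟩
  det m (columns m v)             ∎
  where
  stage : ℕ → ℕ → ℕ → ℤ
  stage t = splice t w v
  step : ∀ t → det m (columns m (stage t)) ≡ det m (columns m (stage (suc t)))
  step t with t ℕ.<? k
  ... | yes t<k = sym (det-columns-addNext m t (ℕₚ.≤-<-trans t<k k<m) (stage t) (stage (suc t)) (+ 1)
                    (λ c r → splice-suc-≢ t w v r)
                    (λ r → begin
                      stage (suc t) t r
                        ≡⟨ splice-new t w v r ⟩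
                      w t r
                        ≡⟨ w-below t r t<k ⟩
                      v t r + v (suc t) r
                        ≡⟨ cong (_+_ (v t r)) (*-identityˡ (v (suc t) r)) ⟨
                      v t r + + 1 * v (suc t) r
                        ≡⟨ cong₂ (λ x y → x + + 1 * y) (splice-old t w v r)
                                 (splice-≮ t w v r (ℕₚ.<-asym (ℕₚ.n<1+n t))) ⟨
                      stage t t r + + 1 * stage t (suc t) r
                        ∎))
  ... | no  t≮k = det-columns-cong m λ c r _ _ → sym (stage-agrees c r)
    where
    stage-agrees : ∀ c r → stage (suc t) c r ≡ stage t c r
    stage-agrees c r with c ℕ.≟ t
    ... | yes refl = trans (splice-new t w v r) (trans (w-above t r (ℕₚ.≮⇒≥ t≮k)) (sym (splice-old t w v r)))
    ... | no  c≢t  = splice-suc-≢ t w v r c≢t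

-- As above, but right to left: stage t has the columns of v before 1 + t + s and those of w from there on.
det-columns-subtractPreviousAbove : ∀ m s (v w : ℕ → ℕ → ℤ) →
                                    (∀ c r → c ≤ s → w c r ≡ v c r) →
                                    (∀ c r → s ≤ c → w (suc c) r ≡ v (suc c) r - v c r) →
                                    det m (columns m w) ≡ det m (columns m v)
det-columns-subtractPreviousAbove m s v w w-below w-above = begin
  det m (columns m w)
    ≡⟨ det-columns-cong m (λ c r _ _ → initial c r) ⟨
  det m (columns m (stage 0))
    ≡⟨ stepwise-constant (λ t → det m (columns m (stage t))) step m ⟩
  det m (columns m (stage m))
    ≡⟨ det-columns-cong m (λ c r c<m _ → splice-< v w r (ℕₚ.m<n⇒m<1+n (ℕₚ.m≤n⇒m≤n+o s c<m))) ⟩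
  det m (columns m v)
    ∎
  where
  stage : ℕ → ℕ → ℕ → ℤ
  stage t = splice (suc (t ℕ.+ s)) v w
  initial : ∀ c r → stage 0 c r ≡ w c r
  initial c r with c ℕ.<? suc s
  ... | yes c<1+s = sym (w-below c r (ℕₚ.≤-pred c<1+s))
  ... | no  _     = refl
  step : ∀ t → det m (columns m (stage t)) ≡ det m (columns m (stage (suc t)))
  step t with suc (t ℕ.+ s) ℕ.<? m
  ... | yes 1+c<m = det-columns-addPrevious m c 1+c<m (stage (suc t)) (stage t) (- + 1)
                      (λ c′ r → sym ∘ splice-suc-≢ (suc c) v w r)
                      (λ r → begin
                        stage t (suc c) r
                          ≡⟨ splice-old (suc c) v w r ⟩
                        w (suc c) r
                          ≡⟨ w-above c r (ℕₚ.m≤n+m s t) ⟩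
                        v (suc c) r - v c r
                          ≡⟨ minus-one (v (suc c) r) (v c r) ⟩
                        v (suc c) r + - + 1 * v c r
                          ≡⟨ cong₂ (λ x y → x + - + 1 * y) (splice-new (suc c) v w r)
                                   (splice-< v w r (ℕₚ.m<n⇒m<1+n (ℕₚ.n<1+n c))) ⟨
                        stage (suc t) (suc c) r + - + 1 * stage (suc t) c r
                          ∎)
    where
    c = t ℕ.+ s
    minus-one : ∀ x y → x - y ≡ x + - + 1 * y
    minus-one = solve-∀
  ... | no  1+c≮m = det-columns-cong m {stage t} {stage (suc t)} λ c r c<m _ →
                      sym (splice-suc-≢ (suc (t ℕ.+ s)) {c} v w r λ { refl → 1+c≮m c<m })

-- Newton's forward differences

Δ : (ℕ → ℕ → ℤ) → ℕ → ℕ → ℤ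
Δ f x r = f (suc x) r - f x r

Δ^ : ℕ → (ℕ → ℕ → ℤ) → ℕ → ℕ → ℤ
Δ^ zero    f = f
Δ^ (suc k) f = Δ (Δ^ k f)

-- Stage k of the reduction: columns c ≤ k are already Δ^c f a, the others are k-th differences
-- at the shifted points a + (c − k).
newtonStage : (ℕ → ℕ → ℤ) → ℕ → ℕ → ℕ → ℕ → ℤ
newtonStage f a k c = Δ^ (c ℕ.⊓ k) f (a ℕ.+ (c ∸ k))

newtonStage-below : ∀ f a {k c} r → c ≤ k → newtonStage f a k c r ≡ Δ^ c f a r
newtonStage-below f a r c≤k = cong₂ (λ j x → Δ^ j f x r) (ℕₚ.m≤n⇒m⊓n≡m c≤k)
                                (trans (cong (a ℕ.+_) (ℕₚ.m≤n⇒m∸n≡0 c≤k)) (ℕₚ.+-identityʳ a))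

newtonStage-above : ∀ f a {k c} r → k ≤ c → newtonStage f a k c r ≡ Δ^ k f (a ℕ.+ (c ∸ k)) r
newtonStage-above f a {k} {c} r k≤c = cong (λ j → Δ^ j f (a ℕ.+ (c ∸ k)) r) (ℕₚ.m≥n⇒m⊓n≡n k≤c)

newtonStage-step : ∀ f a {k c} r → k ≤ c →
                   newtonStage f a (suc k) (suc c) r ≡ newtonStage f a k (suc c) r - newtonStage f a k c r
newtonStage-step f a {k} {c} r k≤c = begin
  newtonStage f a (suc k) (suc c) r
    ≡⟨ newtonStage-above f a r (s≤s k≤c) ⟩
  Δ^ k f (suc (a ℕ.+ (c ∸ k))) r - Δ^ k f (a ℕ.+ (c ∸ k)) r
    ≡⟨ cong₂ (λ x y → Δ^ k f x r - y) shift (newtonStage-above f a r k≤c) ⟨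
  Δ^ k f (a ℕ.+ (suc c ∸ k)) r - newtonStage f a k c r
    ≡⟨ cong (_- newtonStage f a k c r) (newtonStage-above f a r (ℕₚ.m≤n⇒m≤1+n k≤c)) ⟨
  newtonStage f a k (suc c) r - newtonStage f a k c r
    ∎
  where
  shift : a ℕ.+ (suc c ∸ k) ≡ suc (a ℕ.+ (c ∸ k))
  shift = trans (cong (a ℕ.+_) (ℕₚ.+-∸-assoc 1 k≤c)) (ℕₚ.+-suc a (c ∸ k))

det-columns-newton : ∀ m f a → det m (columns m (λ c → f (a ℕ.+ c))) ≡ det m (columns m (λ c → Δ^ c f a))
det-columns-newton m f a = begin
  det m (columns m (λ c → f (a ℕ.+ c)))
    ≡⟨ det-columns-cong m (λ c r _ _ → cong (λ j → Δ^ j f (a ℕ.+ c) r) (ℕₚ.⊓-zeroʳ c)) ⟨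
  det m (columns m (newtonStage f a 0))
    ≡⟨ stepwise-constant (λ k → det m (columns m (newtonStage f a k))) step m ⟩
  det m (columns m (newtonStage f a m))
    ≡⟨ det-columns-cong m (λ c r c<m _ → newtonStage-below f a r (ℕₚ.<⇒≤ c<m)) ⟩
  det m (columns m (λ c → Δ^ c f a))
    ∎
  where
  step : ∀ k → det m (columns m (newtonStage f a k)) ≡ det m (columns m (newtonStage f a (suc k)))
  step k = sym (det-columns-subtractPreviousAbove m k (newtonStage f a k) (newtonStage f a (suc k))
             (λ c r c≤k → trans (newtonStage-below f a r (ℕₚ.m≤n⇒m≤1+n c≤k)) (sym (newtonStage-below f a r c≤k)))
             (λ c r k≤c → newtonStage-step f a r k≤c))

-- The binomial matrix after differencing

binomColumn : ℕ → ℕ → ℤ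
binomColumn x r = + ((x ∸ suc r) C suc r)

-- Row r of the c-th difference of binomColumn at a is C(a − r − 1, r + 1 − c); the guard makes it
-- vanish, instead of C(_, 0) = 1 by truncated subtraction, once c exceeds r + 1.
binomDiff : ℕ → ℕ → ℕ → ℤ
binomDiff a c r with c ℕ.≤? suc r
... | yes _ = + ((a ∸ suc r) C (suc r ∸ c))
... | no  _ = + 0

binomDiff-≤ : ∀ a {c r} → c ≤ suc r → binomDiff a c r ≡ + ((a ∸ suc r) C (suc r ∸ c))
binomDiff-≤ a {c} {r} c≤1+r with c ℕ.≤? suc r
... | yes _     = refl
... | no  c≰1+r = contradiction c≤1+r c≰1+r

binomDiff-> : ∀ a {c r} → suc r < c → binomDiff a c r ≡ + 0
binomDiff-> a {c} {r} 1+r<c with c ℕ.≤? suc r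
... | yes c≤1+r = contradiction c≤1+r (ℕₚ.<⇒≱ 1+r<c)
... | no  _     = refl

binomDiff-superdiagonal : ∀ a r → binomDiff a (suc r) r ≡ + 1
binomDiff-superdiagonal a r = trans (binomDiff-≤ a ℕₚ.≤-refl) (cong (λ j → + ((a ∸ suc r) C j)) (ℕₚ.n∸n≡0 r))

binomDiff-pascal : ∀ a c r → suc r ≤ a → binomDiff (suc a) c r ≡ binomDiff a c r + binomDiff a (suc c) r
binomDiff-pascal a c r 1+r≤a with ℕₚ.<-cmp c (suc r)
... | tri< c<1+r _ _ = begin
  binomDiff (suc a) c r
    ≡⟨ binomDiff-≤ (suc a) (ℕₚ.<⇒≤ c<1+r) ⟩
  + ((suc a ∸ suc r) C (suc r ∸ c))
    ≡⟨ cong₂ (λ x j → + (x C j)) (ℕₚ.+-∸-assoc 1 1+r≤a) (ℕₚ.+-∸-assoc 1 c≤r) ⟩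
  + (suc y C suc j)
    ≡⟨ cong +_ (trans (ℕₚ.+-comm (y C suc j) (y C j)) (nCk+nC[k+1]≡[n+1]C[k+1] y j)) ⟨
  + (y C suc j) + + (y C j)
    ≡⟨ cong₂ (λ x z → + (y C x) + z) (ℕₚ.+-∸-assoc 1 c≤r) (binomDiff-≤ a c<1+r) ⟨
  + (y C (suc r ∸ c)) + binomDiff a (suc c) r
    ≡⟨ cong (_+ binomDiff a (suc c) r) (binomDiff-≤ a (ℕₚ.<⇒≤ c<1+r)) ⟨
  binomDiff a c r + binomDiff a (suc c) r
    ∎
  where
  c≤r = ℕₚ.≤-pred c<1+r
  y = a ∸ suc r
  j = r ∸ c
... | tri≈ _ refl _ = begin
  binomDiff (suc a) (suc r) r
    ≡⟨ binomDiff-superdiagonal (suc a) r ⟩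
  + 1
    ≡⟨ cong₂ _+_ (binomDiff-superdiagonal a r) (binomDiff-> a (ℕₚ.n<1+n (suc r))) ⟨
  binomDiff a (suc r) r + binomDiff a (suc (suc r)) r
    ∎
... | tri> _ _ 1+r<c = begin
  binomDiff (suc a) c r                     ≡⟨ binomDiff-> (suc a) 1+r<c ⟩
  + 0                                       ≡⟨ cong₂ _+_ (binomDiff-> a 1+r<c) (binomDiff-> a (ℕₚ.m<n⇒m<1+n 1+r<c)) ⟨
  binomDiff a c r + binomDiff a (suc c) r   ∎

Δ^-binomColumn : ∀ c a r → suc r ≤ a → Δ^ c binomColumn a r ≡ binomDiff a c r
Δ^-binomColumn zero    a r _     = sym (binomDiff-≤ a z≤n)
Δ^-binomColumn (suc c) a r 1+r≤a = begin
  Δ^ c binomColumn (suc a) r - Δ^ c binomColumn a r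
    ≡⟨ cong₂ _-_ (Δ^-binomColumn c (suc a) r (ℕₚ.m≤n⇒m≤1+n 1+r≤a)) (Δ^-binomColumn c a r 1+r≤a) ⟩
  binomDiff (suc a) c r - binomDiff a c r
    ≡⟨ cong (_- binomDiff a c r) (binomDiff-pascal a c r 1+r≤a) ⟩
  binomDiff a c r + binomDiff a (suc c) r - binomDiff a c r
    ≡⟨ cancel (binomDiff a c r) (binomDiff a (suc c) r) ⟩
  binomDiff a (suc c) r
    ∎
  where cancel : ∀ x y → x + y - x ≡ y
        cancel = solve-∀

binomDiffDet : ℕ → ℕ → ℤ
binomDiffDet a m = det m (columns m (binomDiff a))

binomDiffDet-diagonal : ∀ k → binomDiffDet (suc k) (suc k) ≡ + 0
binomDiffDet-diagonal k = det-zeroRow (suc k) (columns (suc k) (binomDiff (suc k))) (fromℕ k) λ c →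
  trans (cong (binomDiff (suc k) (toℕ c)) (toℕ-fromℕ k)) (lastRow≡0 (ℕₚ.≤-pred (toℕ<n c)))
  where
  lastRow≡0 : ∀ {c} → c ≤ k → binomDiff (suc k) c k ≡ + 0
  lastRow≡0 c≤k = trans (binomDiff-≤ (suc k) (ℕₚ.m≤n⇒m≤1+n c≤k))
                        (cong₂ (λ x j → + (x C j)) (ℕₚ.n∸n≡0 k) (ℕₚ.+-∸-assoc 1 c≤k))

-- Column c for a + 1 is the sum of columns c and c + 1 for a. Splitting the last column, the first
-- summand is undone by column operations, and the second is a unit column which drops the size by one.
binomDiffDet-pascal : ∀ a k → suc k ≤ a →
                      binomDiffDet (suc a) (suc k) ≡ binomDiffDet a (suc k) + binomDiffDet (suc a) k
binomDiffDet-pascal a k 1+k≤a = begin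
  binomDiffDet (suc a) (suc k)
    ≡⟨ det-columns-cong (suc k) (λ c r _ r<1+k → binomDiff-pascal a c r (ℕₚ.≤-trans r<1+k 1+k≤a)) ⟩
  det (suc k) (columns (suc k) sums)
    ≡⟨ det-columns-additive (suc k) sums (lastColumn v) (lastColumn (v ∘ suc)) k (ℕₚ.n<1+n k)
         (λ c r c<1+k c≢k → sym (lastColumn-below v r c<1+k c≢k))
         (λ c r c<1+k c≢k → trans (lastColumn-below (v ∘ suc) r c<1+k c≢k) (sym (lastColumn-below v r c<1+k c≢k)))
         (λ r → sym (cong₂ _+_ (splice-old k sums v r) (splice-old k sums (v ∘ suc) r))) ⟩
  det (suc k) (columns (suc k) (lastColumn v)) + det (suc k) (columns (suc k) (lastColumn (v ∘ suc)))
    ≡⟨ cong₂ _+_ first second ⟩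
  binomDiffDet a (suc k) + binomDiffDet (suc a) k
    ∎
  where
  v = binomDiff a
  sums : ℕ → ℕ → ℤ
  sums c r = v c r + v (suc c) r
  lastColumn : (ℕ → ℕ → ℤ) → ℕ → ℕ → ℤ
  lastColumn = splice k sums
  lastColumn-below : ∀ u {c} r → c < suc k → c ≢ k → lastColumn u c r ≡ sums c r
  lastColumn-below u r c<1+k c≢k = splice-< sums u r (ℕₚ.≤∧≢⇒< (ℕₚ.≤-pred c<1+k) c≢k)
  first : det (suc k) (columns (suc k) (lastColumn v)) ≡ binomDiffDet a (suc k)
  first = det-columns-addNextBelow (suc k) k (ℕₚ.n<1+n k) v (lastColumn v)
            (λ c r c<k → splice-< sums v r c<k) (λ c r k≤c → splice-≮ k sums v r (ℕₚ.≤⇒≯ k≤c))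
  second : det (suc k) (columns (suc k) (lastColumn (v ∘ suc))) ≡ binomDiffDet (suc a) k
  second = begin
    det (suc k) (columns (suc k) (lastColumn (v ∘ suc)))
      ≡⟨ det-columns-unitLast k (lastColumn (v ∘ suc))
           (λ r r<k → trans (splice-old k sums (v ∘ suc) r) (binomDiff-> a (s≤s r<k)))
           (trans (splice-old k sums (v ∘ suc) k) (binomDiff-superdiagonal a k)) ⟩
    det k (columns k (lastColumn (v ∘ suc)))
      ≡⟨ det-columns-cong k (λ c r c<k r<k → trans (splice-< sums (v ∘ suc) r c<k)
                                                   (sym (binomDiff-pascal a c r (ℕₚ.≤-trans r<k (ℕₚ.<⇒≤ 1+k≤a))))) ⟩
    binomDiffDet (suc a) k
      ∎

-- Ballot and Catalan numbers

ballot : ℕ → ℕ → ℤ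
ballot n zero    = + 1
ballot n (suc k) = + ((n ℕ.+ suc k) C suc k) - + ((n ℕ.+ suc k) C k)

ballot-diagonal : ∀ n → ballot n (suc n) ≡ + 0
ballot-diagonal n = begin
  + (N C suc n) - + (N C n)   ≡⟨ cong (λ j → + j - + (N C n)) symmetric ⟩
  + (N C n) - + (N C n)       ≡⟨ +-inverseʳ (+ (N C n)) ⟩
  + 0                         ∎
  where
  N = n ℕ.+ suc n
  symmetric : N C suc n ≡ N C n
  symmetric = trans (nCk≡nC[n∸k] (ℕₚ.m≤n+m (suc n) n)) (cong (N C_) (ℕₚ.m+n∸n≡m n (suc n)))

ballot-pascal : ∀ n k → ballot (suc n) (suc k) ≡ ballot n (suc k) + ballot (suc n) k
ballot-pascal n zero = begin
  + ((suc n ℕ.+ 1) C 1) - + 1       ≡⟨ cong (λ x → + x - + 1) (trans (nC1≡n (suc n ℕ.+ 1)) (ℕₚ.+-comm (suc n) 1)) ⟩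
  + (suc (suc n)) - + 1             ≡⟨ shift (+ n) ⟩
  (+ (suc n) - + 1) + + 1           ≡⟨ cong (λ x → (+ x - + 1) + + 1) (trans (ℕₚ.+-comm 1 n) (sym (nC1≡n (n ℕ.+ 1)))) ⟩
  (+ ((n ℕ.+ 1) C 1) - + 1) + + 1   ∎
  where shift : ∀ x → + 1 + (+ 1 + x) - + 1 ≡ (+ 1 + x - + 1) + + 1
        shift = solve-∀
ballot-pascal n (suc k) = begin
  + (suc M C suc (suc k)) - + (suc M C suc k)
    ≡⟨ cong₂ (λ x y → + x - + y) (nCk+nC[k+1]≡[n+1]C[k+1] M (suc k)) (nCk+nC[k+1]≡[n+1]C[k+1] M k) ⟨
  + (M C suc k ℕ.+ M C suc (suc k)) - + (M C k ℕ.+ M C suc k)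
    ≡⟨ regroup (M C k) (M C suc k) (M C suc (suc k)) ⟩
  (+ (M C suc (suc k)) - + (M C suc k)) + (+ (M C suc k) - + (M C k))
    ≡⟨ cong (λ N → ballot n (suc (suc k)) + (+ (N C suc k) - + (N C k))) (ℕₚ.+-suc n (suc k)) ⟩
  ballot n (suc (suc k)) + ballot (suc n) (suc k)
    ∎
  where
  M = n ℕ.+ suc (suc k)
  regroup : ∀ a b c → + (b ℕ.+ c) - + (a ℕ.+ b) ≡ (+ c - + b) + (+ b - + a)
  regroup a b c rewrite pos-+ b c | pos-+ a b = ring (+ a) (+ b) (+ c)
    where ring : ∀ a b c → b + c - (a + b) ≡ (c - b) + (b - a)
          ring = solve-∀

binomDiffDet≡ballot : ∀ n m → m ≤ suc n → binomDiffDet (suc n) m ≡ ballot n m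
binomDiffDet≡ballot n       zero          _ = refl
binomDiffDet≡ballot zero    (suc zero)    _ = binomDiffDet-diagonal 0
binomDiffDet≡ballot zero    (suc (suc _)) (s≤s ())
binomDiffDet≡ballot (suc n) (suc k) (s≤s k≤1+n) with ℕₚ.m≤n⇒m<n∨m≡n k≤1+n
... | inj₂ refl  = trans (binomDiffDet-diagonal (suc n)) (sym (ballot-diagonal (suc n)))
... | inj₁ k<1+n = begin
  binomDiffDet (suc (suc n)) (suc k)
    ≡⟨ binomDiffDet-pascal (suc n) k k<1+n ⟩
  binomDiffDet (suc n) (suc k) + binomDiffDet (suc (suc n)) k
    ≡⟨ cong₂ _+_ (binomDiffDet≡ballot n (suc k) k<1+n) (binomDiffDet≡ballot (suc n) k (ℕₚ.m≤n⇒m≤1+n k≤1+n)) ⟩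
  ballot n (suc k) + ballot (suc n) k
    ≡⟨ ballot-pascal n k ⟨
  ballot (suc n) (suc k)
    ∎

[1+k]*[1+n]C[1+k]≡[1+n]*nCk : ∀ n k → suc k ℕ.* (suc n C suc k) ≡ suc n ℕ.* (n C k)
[1+k]*[1+n]C[1+k]≡[1+n]*nCk zero    zero    = refl
[1+k]*[1+n]C[1+k]≡[1+n]*nCk zero    (suc k) = ℕₚ.*-zeroʳ (suc (suc k))
[1+k]*[1+n]C[1+k]≡[1+n]*nCk (suc n) zero    =
  trans (ℕₚ.+-identityʳ _) (trans (nC1≡n (suc (suc n))) (sym (ℕₚ.*-identityʳ _)))
[1+k]*[1+n]C[1+k]≡[1+n]*nCk (suc n) (suc k) = begin
  suc (suc k) ℕ.* (suc (suc n) C suc (suc k))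
    ≡⟨ cong (suc (suc k) ℕ.*_) (nCk+nC[k+1]≡[n+1]C[k+1] (suc n) (suc k)) ⟨
  suc (suc k) ℕ.* (a ℕ.+ b)
    ≡⟨ expand (suc k) a b ⟩
  a ℕ.+ suc k ℕ.* a ℕ.+ suc (suc k) ℕ.* b
    ≡⟨ cong₂ (λ x y → a ℕ.+ x ℕ.+ y) ([1+k]*[1+n]C[1+k]≡[1+n]*nCk n k) ([1+k]*[1+n]C[1+k]≡[1+n]*nCk n (suc k)) ⟩
  a ℕ.+ suc n ℕ.* (n C k) ℕ.+ suc n ℕ.* (n C suc k)
    ≡⟨ collect a (suc n) (n C k) (n C suc k) ⟩
  a ℕ.+ suc n ℕ.* (n C k ℕ.+ n C suc k)
    ≡⟨ cong (λ x → a ℕ.+ suc n ℕ.* x) (nCk+nC[k+1]≡[n+1]C[k+1] n k) ⟩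
  suc (suc n) ℕ.* a
    ∎
  where
  a = suc n C suc k
  b = suc n C suc (suc k)
  expand : ∀ k a b → suc k ℕ.* (a ℕ.+ b) ≡ a ℕ.+ k ℕ.* a ℕ.+ suc k ℕ.* b
  expand = ℕ-solve-∀
  collect : ∀ a n c d → a ℕ.+ n ℕ.* c ℕ.+ n ℕ.* d ≡ a ℕ.+ n ℕ.* (c ℕ.+ d)
  collect = ℕ-solve-∀

[1+k]*nC[1+k]≡[n∸k]*nCk : ∀ n k → suc k ℕ.* (n C suc k) ≡ (n ∸ k) ℕ.* (n C k)
[1+k]*nC[1+k]≡[n∸k]*nCk n k = begin
  suc k ℕ.* (n C suc k)
    ≡⟨ ℕₚ.m+n∸n≡m _ (suc k ℕ.* (n C k)) ⟨
  suc k ℕ.* (n C suc k) ℕ.+ suc k ℕ.* (n C k) ∸ suc k ℕ.* (n C k)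
    ≡⟨ cong (_∸ suc k ℕ.* (n C k)) pascal ⟩
  suc k ℕ.* (suc n C suc k) ∸ suc k ℕ.* (n C k)
    ≡⟨ cong (_∸ suc k ℕ.* (n C k)) ([1+k]*[1+n]C[1+k]≡[1+n]*nCk n k) ⟩
  suc n ℕ.* (n C k) ∸ suc k ℕ.* (n C k)
    ≡⟨ ℕₚ.*-distribʳ-∸ (n C k) (suc n) (suc k) ⟨
  (n ∸ k) ℕ.* (n C k)
    ∎
  where
  pascal : suc k ℕ.* (n C suc k) ℕ.+ suc k ℕ.* (n C k) ≡ suc k ℕ.* (suc n C suc k)
  pascal = trans (sym (ℕₚ.*-distribˡ-+ (suc k) (n C suc k) (n C k)))
             (cong (suc k ℕ.*_) (trans (ℕₚ.+-comm (n C suc k) (n C k)) (nCk+nC[k+1]≡[n+1]C[k+1] n k)))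

[2+2m]C[1+m]≡[1+2m]Cm+[1+2m]Cm : ∀ m → (suc m ℕ.+ suc m) C suc m ≡ (suc m ℕ.+ m) C m ℕ.+ (suc m ℕ.+ m) C m
[2+2m]C[1+m]≡[1+2m]Cm+[1+2m]Cm m = ℕₚ.*-cancelˡ-≡ _ _ (suc m) (begin
  suc m ℕ.* ((suc m ℕ.+ suc m) C suc m)   ≡⟨ cong (λ x → suc m ℕ.* (suc x C suc m)) (ℕₚ.+-suc m m) ⟩
  suc m ℕ.* (suc N C suc m)               ≡⟨ [1+k]*[1+n]C[1+k]≡[1+n]*nCk N m ⟩
  suc N ℕ.* (N C m)                       ≡⟨ double m (N C m) ⟩
  suc m ℕ.* (N C m ℕ.+ N C m)             ∎)
  where
  N = suc m ℕ.+ m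
  double : ∀ m y → suc (suc m ℕ.+ m) ℕ.* y ≡ suc m ℕ.* (y ℕ.+ y)
  double = ℕ-solve-∀

-- With n = k + 2, Y = C(2n − 1, n − 1) and X = C(2n − 1, n − 2): C(2n, n) = 2Y and
-- (n + 1)·X = (n − 1)·Y, so (n + 1)·(Y − X) = C(2n, n).
ballot-catalan : ∀ k → ballot (suc (suc k)) (suc k) ≡ + catalan (suc (suc k))
ballot-catalan k = begin
  + Y - + X      ≡⟨ m-n≡m⊖n Y X ⟩
  Y ⊖ X          ≡⟨ ⊖-≥ X≤Y ⟩
  + (Y ∸ X)      ≡⟨ cong +_ catalan≡Y∸X ⟨
  + catalan n    ∎
  where
  n = suc (suc k)
  N = n ℕ.+ suc k
  Y = N C suc k
  X = N C k
  N∸k : N ∸ k ≡ suc n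
  N∸k = trans (cong (_∸ k) (N≡k+3 k)) (ℕₚ.m+n∸m≡n k (suc n))
    where N≡k+3 : ∀ k → suc (suc k) ℕ.+ suc k ≡ k ℕ.+ suc (suc (suc k))
          N≡k+3 = ℕ-solve-∀
  ratio : suc n ℕ.* X ≡ suc k ℕ.* Y
  ratio = sym (trans ([1+k]*nC[1+k]≡[n∸k]*nCk N k) (cong (ℕ._* X) N∸k))
  X≤Y : X ≤ Y
  X≤Y = ℕₚ.*-cancelˡ-≤ (suc n) (subst (ℕ._≤ suc n ℕ.* Y) (sym ratio) (ℕₚ.*-monoˡ-≤ Y (ℕₚ.m≤n+m (suc k) 2)))
  catalan≡Y∸X : catalan n ≡ Y ∸ X
  catalan≡Y∸X = begin
    ((n ℕ.+ n) C n) / suc n                             ≡⟨ cong (_/ suc n) ([2+2m]C[1+m]≡[1+2m]Cm+[1+2m]Cm (suc k)) ⟩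
    (Y ℕ.+ Y) / suc n                                   ≡⟨ cong (_/ suc n) (ℕₚ.m+n∸n≡m (Y ℕ.+ Y) (suc k ℕ.* Y)) ⟨
    ((Y ℕ.+ Y) ℕ.+ suc k ℕ.* Y ∸ suc k ℕ.* Y) / suc n   ≡⟨ cong (_/ suc n) (cong₂ _∸_ (expand k Y) ratio) ⟨
    (Y ℕ.* suc n ∸ suc n ℕ.* X) / suc n                 ≡⟨ cong (λ x → (Y ℕ.* suc n ∸ x) / suc n) (ℕₚ.*-comm (suc n) X) ⟩
    (Y ℕ.* suc n ∸ X ℕ.* suc n) / suc n                 ≡⟨ cong (_/ suc n) (ℕₚ.*-distribʳ-∸ (suc n) Y X) ⟨
    (Y ∸ X) ℕ.* suc n / suc n                           ≡⟨ m*n/n≡m (Y ∸ X) (suc n) ⟩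
    Y ∸ X                                               ∎
    where expand : ∀ k y → y ℕ.* suc (suc (suc k)) ≡ (y ℕ.+ y) ℕ.+ suc k ℕ.* y
          expand = ℕ-solve-∀

binomMatrix≡columns : ∀ n r c → binomMatrix n r c ≡ columns (n ∸ 1) (λ c → binomColumn (suc n ℕ.+ c)) r c
binomMatrix≡columns n r c = cong (λ x → + (x C suc (toℕ r))) (begin
  n ∸ suc (toℕ r) ℕ.+ suc (toℕ c)   ≡⟨ ℕₚ.+-∸-comm (suc (toℕ c)) (ℕₚ.≤-trans (toℕ<n r) (ℕₚ.m∸n≤m n 1)) ⟨
  n ℕ.+ suc (toℕ c) ∸ suc (toℕ r)   ≡⟨ cong (_∸ suc (toℕ r)) (ℕₚ.+-suc n (toℕ c)) ⟩
  suc n ℕ.+ toℕ c ∸ suc (toℕ r)     ∎)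

corollary8p3 : (n : ℕ) → 2 ≤ n → det (n ∸ 1) (binomMatrix n) ≡ + catalan n
corollary8p3 (suc (suc k)) (s≤s (s≤s z≤n)) = begin
  det (suc k) (binomMatrix n)
    ≡⟨ det-cong (suc k) (binomMatrix≡columns n) ⟩
  det (suc k) (columns (suc k) (λ c → binomColumn (suc n ℕ.+ c)))
    ≡⟨ det-columns-newton (suc k) binomColumn (suc n) ⟩
  det (suc k) (columns (suc k) (λ c → Δ^ c binomColumn (suc n)))
    ≡⟨ det-columns-cong (suc k) (λ c r _ r<1+k → Δ^-binomColumn c (suc n) r (ℕₚ.≤-trans r<1+k (ℕₚ.m≤n+m (suc k) 2))) ⟩
  binomDiffDet (suc n) (suc k)
    ≡⟨ binomDiffDet≡ballot n (suc k) (ℕₚ.m≤n+m (suc k) 2) ⟩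
  ballot n (suc k)
    ≡⟨ ballot-catalan k ⟩
  + catalan n
    ∎
  where n = suc (suc k)
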